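{- Let $m<n$ be integers such that either $m\ge 5$ and $n\le 2^m-\lceil m/2\rceil$, or $(m,n)\in\{(2,3),(3,4),(3,5),(3,6)\}\cup\{(4,p):5\le p\le 13\}$. Then $D_{\min}(K_{m,n})=D'_{\min}(K_{m,n})=1$, $\chi_{D,\min}(K_{m,n})=2$ and $\chi'_{D,\min}(K_{m,n})=n$.
   Context: $K_{m,n}$ is the complete bipartite graph with parts of sizes $m$ and $n$. An orientation of a simple graph assigns one direction to each edge. An automorphism of an oriented graph is a permutation $\phi$ of its vertices such that $\phi(u)\phi(v)$ is an arc whenever $uv$ is an arc. An $r$-vertex-labelling maps vertices to $\{1,\dots,r\}$, an $r$-arc-labelling maps arcs to $\{1,\dots,r\}$; colourings are proper labellings (adjacent vertices, resp. arcs sharing an end-vertex, get distinct labels). A labelling $\lambda$ is distinguishing if the only automorphism $\phi$ with $\lambda(\phi(u))=\lambda(u)$ for all vertices (resp. $\lambda(\phi(u)\phi(v))=\lambda(uv)$ for all arcs) is the identity. For an oriented graph $\vec G$, $D(\vec G)$, $\chi_D(\vec G)$, $D'(\vec G)$, $\chi'_D(\vec G)$ are the least $r$ for which $\vec G$ admits a distinguishing $r$-vertex-labelling, $r$-vertex-colouring, $r$-arc-labelling, $r$-arc-colouring. For an undirected graph $G$, $D_{\min}(G)$, $\chi_{D,\min}(G)$, $D'_{\min}(G)$, $\chi'_{D,\min}(G)$ are the minima of these respective parameters over all orientations of $G$. -}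

module Defs where

open import Data.Nat using (ℕ; _≤_; _<_; _^_; _∸_; ⌈_/2⌉)
open import Data.Fin using (Fin)
open import Data.Bool using (Bool; true; false; T; not)
open import Data.Sum using (_⊎_; inj₁; inj₂)
open import Data.Product using (Σ; _×_; _,_)
open import Data.Maybe using (Maybe; just; nothing)
open import Data.Empty using (⊥)
open import Relation.Binary.PropositionalEquality using (_≡_; _≢_)
open import Function.Bundles using (_↔_; Inverse)

V : ℕ → ℕ → Set
V m n = Fin m ⊎ Fin n

-- An orientation of K_{m,n}: for each edge {i,j} (i left, j right),
-- true means the arc i → j, false means the arc j → i.
Orientation : ℕ → ℕ → Set
Orientation m n = Fin m → Fin n → Bool

Arc : ∀ {m n} → Orientation m n → V m n → V m n → Set
Arc o (inj₁ i) (inj₂ j) = T (o i j)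
Arc o (inj₂ j) (inj₁ i) = T (not (o i j))
Arc o (inj₁ _) (inj₁ _) = ⊥
Arc o (inj₂ _) (inj₂ _) = ⊥

Automorphism : ∀ {m n} → Orientation m n → Set
Automorphism {m} {n} o =
  Σ (V m n ↔ V m n) λ φ →
    ∀ u v → Arc o u v → Arc o (Inverse.to φ u) (Inverse.to φ v)

-- r-vertex-labellings (labels {1..r} represented by Fin r).
VLabelling : ℕ → ℕ → ℕ → Set
VLabelling m n r = V m n → Fin r

-- r-arc-labellings: every edge carries exactly one arc, so an arc-labelling
-- is a label on each edge {i,j}.
ALabelling : ℕ → ℕ → ℕ → Set
ALabelling m n r = Fin m → Fin n → Fin r

arcLabel : ∀ {m n r} → ALabelling m n r → V m n → V m n → Maybe (Fin r)
arcLabel ℓ (inj₁ i) (inj₂ j) = just (ℓ i j)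
arcLabel ℓ (inj₂ j) (inj₁ i) = just (ℓ i j)
arcLabel ℓ (inj₁ _) (inj₁ _) = nothing
arcLabel ℓ (inj₂ _) (inj₂ _) = nothing

VDistinguishing : ∀ {m n r} (o : Orientation m n) → VLabelling m n r → Set
VDistinguishing {m} {n} o λv =
  (φ : Automorphism o) →
  (∀ u → λv (Inverse.to (Data.Product.proj₁ φ) u) ≡ λv u) →
  ∀ u → Inverse.to (Data.Product.proj₁ φ) u ≡ u
  where import Data.Product

ADistinguishing : ∀ {m n r} (o : Orientation m n) → ALabelling m n r → Set
ADistinguishing {m} {n} o ℓ =
  (φ : Automorphism o) →
  (∀ u v → Arc o u v →
     arcLabel ℓ (Inverse.to (Data.Product.proj₁ φ) u) (Inverse.to (Data.Product.proj₁ φ) v)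
       ≡ arcLabel ℓ u v) →
  ∀ u → Inverse.to (Data.Product.proj₁ φ) u ≡ u
  where import Data.Product

ProperV : ∀ {m n r} → VLabelling m n r → Set
ProperV {m} {n} λv = ∀ (i : Fin m) (j : Fin n) → λv (inj₁ i) ≢ λv (inj₂ j)

ProperA : ∀ {m n r} → ALabelling m n r → Set
ProperA {m} {n} ℓ =
  (∀ (i : Fin m) (j j' : Fin n) → j ≢ j' → ℓ i j ≢ ℓ i j') ×
  (∀ (i i' : Fin m) (j : Fin n) → i ≢ i' → ℓ i j ≢ ℓ i' j)

HasD : ∀ {m n} → Orientation m n → ℕ → Set
HasD {m} {n} o r = Σ (VLabelling m n r) λ λv → VDistinguishing o λv

HasχD : ∀ {m n} → Orientation m n → ℕ → Set
HasχD {m} {n} o r = Σ (VLabelling m n r) λ λv → ProperV λv × VDistinguishing o λv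

HasD' : ∀ {m n} → Orientation m n → ℕ → Set
HasD' {m} {n} o r = Σ (ALabelling m n r) λ ℓ → ADistinguishing o ℓ

HasχD' : ∀ {m n} → Orientation m n → ℕ → Set
HasχD' {m} {n} o r = Σ (ALabelling m n r) λ ℓ → ProperA ℓ × ADistinguishing o ℓ

IsLeast : (ℕ → Set) → ℕ → Set
IsLeast P k = P k × (∀ r → P r → k ≤ r)

MinOverOrientations : (m n : ℕ) → (Orientation m n → ℕ → Set) → ℕ → Set
MinOverOrientations m n Has k =
  Σ (Orientation m n) (λ o → IsLeast (Has o) k) ×
  (∀ (o : Orientation m n) r → Has o r → k ≤ r)

Dmin χDmin D'min χ'Dmin : (m n : ℕ) → ℕ → Set
Dmin m n = MinOverOrientations m n HasD
χDmin m n = MinOverOrientations m n HasχD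
D'min m n = MinOverOrientations m n HasD'
χ'Dmin m n = MinOverOrientations m n HasχD'

Hyp : ℕ → ℕ → Set
Hyp m n =
  (5 ≤ m × n ≤ 2 ^ m ∸ ⌈ m /2⌉) ⊎
  ((m ≡ 2 × n ≡ 3) ⊎
  ((m ≡ 3 × 4 ≤ n × n ≤ 6) ⊎
   (m ≡ 4 × 5 ≤ n × n ≤ 13)))

module Submission where

-- Corollary 2.2: for the pairs (m, n) of the hypothesis, K_{m,n} has a rigid
-- orientation, i.e. one whose only automorphism is the identity.  On a rigid
-- orientation every labelling is distinguishing, so each of D_min, D'_min,
-- χ_D,min and χ'_D,min equals the trivial lower bound valid for every
-- orientation (one label; one label; two colours across an edge; n colours at a
-- left vertex of degree n), realised by constant labellings, the bipartition
-- colouring and a Latin-rectangle arc colouring.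
--
-- Rigid orientations are built as Boolean m × n matrices (entry (i, j) true
-- iff the arc goes i → j).  Since m < n, automorphisms fix the two sides, so it
-- suffices that no nontrivial pair of row and column permutations preserves the
-- matrix ("matrix-rigid").  Two criteria give this:
--   1. distinct columns and rows with pairwise distinct numbers of ones;
--   2. the columns are all columns outside a set R of pairwise distinct
--      weights that separates the rows.
-- Criterion 1 handles m < n ≤ 2^m - m + 1 (a staircase plus complementary
-- pairs of columns), Criterion 2 handles 2^m - m + 2 ≤ n ≤ 2^m - ⌈m/2⌉ for
-- m ≥ 5 (R = ⌈m/2⌉ separating "hooked prefix" columns plus runs of ones).

open import Defs
open import Data.Nat using (ℕ; zero; suc; _+_; _∸_; _^_; _≤_; _<_; z≤n; s≤s; ⌈_/2⌉; _<ᵇ_; _<?_; _≤?_)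
open import Data.Nat.Properties
open import Data.Nat.Tactic.RingSolver using (solve-∀)
open import Data.Fin using (Fin; zero; suc; toℕ; fromℕ<) renaming (_≟_ to _≟ᶠ_)
open import Data.Fin.Properties using (pigeonhole; toℕ-injective; toℕ<n; toℕ-fromℕ<; injective⇒≤)
open import Data.Bool using (Bool; true; false; T; not; if_then_else_)
import Data.Bool as Bool
open import Data.Bool.Properties using (not-involutive; T-≡; T-not-≡)
open import Data.Sum using (_⊎_; inj₁; inj₂)
open import Data.Sum.Properties using (inj₁-injective; inj₂-injective)
open import Data.Product using (Σ; _×_; _,_; proj₁; proj₂)
open import Data.Empty using (⊥-elim)
open import Data.Unit using (tt)
open import Data.Vec using (Vec; []; _∷_; lookup; tabulate)
import Data.Vec as Vec
open import Data.Vec.Properties using (tabulate∘lookup; lookup∘tabulate; tabulate-cong)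
import Data.Vec.Properties as Vecₚ
open import Data.List as L using (List; []; _∷_; _++_; length)
open import Data.List.Properties using (length-++; length-map; length-take; length-replicate; length-applyUpTo)
open import Data.List.Membership.Propositional using (_∈_; _∉_)
open import Data.List.Membership.Propositional.Properties
  using (∈-lookup; ∈-++⁺ˡ; ∈-++⁺ʳ; ∈-++⁻; ∈-map⁺; ∈-map⁻; ∈-applyUpTo⁺; ∈-applyUpTo⁻; ∈-filter⁺; ∈-filter⁻)
open import Data.List.Membership.Propositional.Properties.WithK using (unique∧set⇒bag)
import Data.List.Membership.DecPropositional as DecMembership
open import Data.List.Relation.Binary.BagAndSetEquality using (∼bag⇒↭)
open import Data.List.Relation.Binary.Permutation.Propositional.Properties using (↭-length)
open import Data.List.Relation.Unary.All as All using ([]; _∷_)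
open import Data.List.Relation.Unary.AllPairs using ([]; _∷_)
open import Data.List.Relation.Unary.Any using (here; there)
import Data.List.Relation.Unary.Any as Any
open import Data.List.Relation.Unary.Any.Properties using (lookup-index)
open import Data.List.Relation.Unary.Unique.Propositional using (Unique)
import Data.List.Relation.Unary.Unique.Propositional.Properties as Unique
open import Algebra.Properties.CommutativeMonoid.Sum +-0-commutativeMonoid using (sum; sum-permute; sum-cong-≗)
open import Function using (_∘_)
open import Function.Bundles using (_↔_; Inverse; mk↔ₛ′; _⇔_; mk⇔; Equivalence)
open import Relation.Binary.Definitions using (tri<; tri≈; tri>)
open import Relation.Binary.PropositionalEquality
open import Relation.Nullary using (¬_; ¬?; yes; no)
open import Relation.Unary using (Decidable)

Rigid : ∀ {m n} → Orientation m n → Set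
Rigid o = (φ : Automorphism o) → ∀ u → Inverse.to (proj₁ φ) u ≡ u

MatrixRigid : ∀ {m n} → Orientation m n → Set
MatrixRigid {m} {n} o = ∀ (σ : Fin m ↔ Fin m) (τ : Fin n ↔ Fin n) →
  (∀ i j → o (Inverse.to σ i) (Inverse.to τ j) ≡ o i j) →
  (∀ i → Inverse.to σ i ≡ i) × (∀ j → Inverse.to τ j ≡ j)

module Restriction {A X : Set} (φ : X ↔ X) (ι : A → X) (ι-injective : ∀ {a a'} → ι a ≡ ι a' → a ≡ a')
  (to-stays   : ∀ a → Σ A λ a' → Inverse.to φ (ι a) ≡ ι a')
  (from-stays : ∀ a → Σ A λ a' → Inverse.from φ (ι a) ≡ ι a') where

  open Inverse φ using (to; from; strictlyInverseˡ; strictlyInverseʳ)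

  restriction : A ↔ A
  restriction = mk↔ₛ′ (proj₁ ∘ to-stays) (proj₁ ∘ from-stays)
    (λ a → ι-injective (begin
      ι (proj₁ (to-stays (proj₁ (from-stays a)))) ≡⟨ proj₂ (to-stays _) ⟨
      to (ι (proj₁ (from-stays a)))              ≡⟨ cong to (proj₂ (from-stays a)) ⟨
      to (from (ι a))                            ≡⟨ strictlyInverseˡ (ι a) ⟩
      ι a                                        ∎))
    (λ a → ι-injective (begin
      ι (proj₁ (from-stays (proj₁ (to-stays a)))) ≡⟨ proj₂ (from-stays _) ⟨
      from (ι (proj₁ (to-stays a)))              ≡⟨ cong from (proj₂ (to-stays a)) ⟨
      from (to (ι a))                            ≡⟨ strictlyInverseʳ (ι a) ⟩
      ι a                                        ∎))
    where open ≡-Reasoning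

Adjacent : ∀ {m n} → Orientation m n → V m n → V m n → Set
Adjacent o u v = Arc o u v ⊎ Arc o v u

cross-adjacent : ∀ {m n} (o : Orientation m n) i j → Adjacent o (inj₁ i) (inj₂ j)
cross-adjacent o i j with o i j
... | true  = inj₁ tt
... | false = inj₂ tt

left-nonadjacent : ∀ {m n} (o : Orientation m n) {i i'} → ¬ Adjacent o (inj₁ i) (inj₁ i')
left-nonadjacent o (inj₁ ())
left-nonadjacent o (inj₂ ())

right-nonadjacent : ∀ {m n} (o : Orientation m n) {j j'} → ¬ Adjacent o (inj₂ j) (inj₂ j')
right-nonadjacent o (inj₁ ())
right-nonadjacent o (inj₂ ())

-- When m < n every automorphism of an orientation of K_{m,n} preserves the two
-- sides, hence is a pair (σ, τ) of permutations of the rows and columns that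
-- preserves the orientation matrix.
module AutomorphismOfKmn {m n} (o : Orientation m n) (m<n : m < n) (φ : Automorphism o) where

  open Inverse (proj₁ φ) using (to; from; strictlyInverseˡ; strictlyInverseʳ)

  to-injective : ∀ {u v} → to u ≡ to v → u ≡ v
  to-injective {u} {v} e = trans (sym (strictlyInverseʳ u)) (trans (cong from e) (strictlyInverseʳ v))

  adjacent-preserved : ∀ {u v} → Adjacent o u v → Adjacent o (to u) (to v)
  adjacent-preserved (inj₁ a) = inj₁ (proj₂ φ _ _ a)
  adjacent-preserved (inj₂ a) = inj₂ (proj₂ φ _ _ a)

  -- If a left vertex went right, all n right vertices (its neighbours) would
  -- be sent injectively into the m left vertices, contradicting m < n.
  left : ∀ i → Σ (Fin m) λ i' → to (inj₁ i) ≡ inj₁ i'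
  left i with to (inj₁ i) in e
  ... | inj₁ i' = i' , refl
  ... | inj₂ k  = ⊥-elim (pigeonhole-contradiction (pigeonhole m<n (λ j → proj₁ (image j))))
    where
      image : ∀ j → Σ (Fin m) λ i' → to (inj₂ j) ≡ inj₁ i'
      image j with to (inj₂ j) in e'
      ... | inj₁ i' = i' , refl
      ... | inj₂ k' = ⊥-elim (right-nonadjacent o {k} {k'} (subst₂ (Adjacent o) e e' (adjacent-preserved (cross-adjacent o i j))))
      pigeonhole-contradiction : ¬ Σ (Fin n) λ j → Σ (Fin n) λ j' → toℕ j < toℕ j' × proj₁ (image j) ≡ proj₁ (image j')
      pigeonhole-contradiction (j , j' , j<j' , same)
        with refl ← to-injective (trans (proj₂ (image j)) (trans (cong inj₁ same) (sym (proj₂ (image j')))))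
        = <-irrefl refl j<j'

  -- A right vertex going left would become adjacent to the (left) image of a left vertex.
  right : ∀ j → Σ (Fin n) λ j' → to (inj₂ j) ≡ inj₂ j'
  right j with to (inj₂ j) in e
  ... | inj₂ j' = j' , refl
  ... | inj₁ i' with left i'
  ... | i'' , e' = ⊥-elim (left-nonadjacent o {i''} {i'} (subst₂ (Adjacent o) e' e (adjacent-preserved (cross-adjacent o i' j))))

  from-left : ∀ i → Σ (Fin m) λ i' → from (inj₁ i) ≡ inj₁ i'
  from-left i with from (inj₁ i) in e
  ... | inj₁ i' = i' , refl
  ... | inj₂ j with () ← trans (sym (strictlyInverseˡ (inj₁ i))) (trans (cong to e) (proj₂ (right j)))

  from-right : ∀ j → Σ (Fin n) λ j' → from (inj₂ j) ≡ inj₂ j'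
  from-right j with from (inj₂ j) in e
  ... | inj₂ j' = j' , refl
  ... | inj₁ i with () ← trans (sym (strictlyInverseˡ (inj₂ j))) (trans (cong to e) (proj₂ (left i)))

  σ : Fin m ↔ Fin m
  σ = Restriction.restriction (proj₁ φ) inj₁ inj₁-injective left from-left

  τ : Fin n ↔ Fin n
  τ = Restriction.restriction (proj₁ φ) inj₂ inj₂-injective right from-right

  matrix-preserved : ∀ i j → o (Inverse.to σ i) (Inverse.to τ j) ≡ o i j
  matrix-preserved i j with o i j in e
  ... | true  = Equivalence.to T-≡
        (subst₂ (Arc o) (proj₂ (left i)) (proj₂ (right j)) (proj₂ φ (inj₁ i) (inj₂ j) (Equivalence.from T-≡ e)))
  ... | false = Equivalence.to T-not-≡
        (subst₂ (Arc o) (proj₂ (right j)) (proj₂ (left i)) (proj₂ φ (inj₂ j) (inj₁ i) (Equivalence.from T-not-≡ e)))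

rigid-if-matrixRigid : ∀ {m n} (o : Orientation m n) → m < n → MatrixRigid o → Rigid o
rigid-if-matrixRigid o m<n rigidMatrix φ (inj₁ i) =
  trans (proj₂ (left i)) (cong inj₁ (proj₁ (rigidMatrix σ τ matrix-preserved) i))
  where open AutomorphismOfKmn o m<n φ
rigid-if-matrixRigid o m<n rigidMatrix φ (inj₂ j) =
  trans (proj₂ (right j)) (cong inj₂ (proj₂ (rigidMatrix σ τ matrix-preserved) j))
  where open AutomorphismOfKmn o m<n φ

bit : Bool → ℕ
bit true  = 1
bit false = 0

outDegree : ∀ {m n} → Orientation m n → Fin m → ℕ
outDegree o i = sum (λ j → bit (o i j))

-- Row sums are
-- invariant under column permutations, so σ fixes every row; τ then maps
-- each column to an equal column.
matrixRigid-by-degrees : ∀ {m n} (o : Orientation m n) →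
  (∀ i i' → outDegree o i ≡ outDegree o i' → i ≡ i') →
  (∀ j j' → (∀ i → o i j ≡ o i j') → j ≡ j') →
  MatrixRigid o
matrixRigid-by-degrees o rowsDistinct columnsDistinct σ τ preserved = σ-id , τ-id
  where
    σ-id : ∀ i → Inverse.to σ i ≡ i
    σ-id i = rowsDistinct (Inverse.to σ i) i
      (trans (sum-permute (λ j → bit (o (Inverse.to σ i) j)) τ)
             (sum-cong-≗ (λ j → cong bit (preserved i j))))
    τ-id : ∀ j → Inverse.to τ j ≡ j
    τ-id j = sym (columnsDistinct j (Inverse.to τ j)
      (λ i → trans (sym (preserved i j)) (cong (λ x → o x (Inverse.to τ j)) (σ-id i))))

-- A right vertex j is described by its column: the Boolean vector recording,
-- for each left vertex i, whether the arc goes i → j.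
Column : ℕ → Set
Column m = Vec Bool m

weight : ∀ {m} → Column m → ℕ
weight v = sum (λ i → bit (lookup v i))

columnsOf : ∀ {m} (C : List (Column m)) → Orientation m (length C)
columnsOf C i j = lookup (L.lookup C j) i

column-ext : ∀ {m} {v w : Column m} → (∀ i → lookup v i ≡ lookup w i) → v ≡ w
column-ext {v = v} {w} same = begin
  v                  ≡⟨ tabulate∘lookup v ⟨
  tabulate (lookup v) ≡⟨ tabulate-cong same ⟩
  tabulate (lookup w) ≡⟨ tabulate∘lookup w ⟩
  w                  ∎
  where open ≡-Reasoning

lookup-injective : ∀ {A : Set} (xs : List A) → Unique xs →
  ∀ j j' → L.lookup xs j ≡ L.lookup xs j' → j ≡ j'
lookup-injective (x ∷ xs) _          zero    zero     _ = refl
lookup-injective (x ∷ xs) (x∉xs ∷ _) zero    (suc j') e = ⊥-elim (All.lookup x∉xs (∈-lookup j') e)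
lookup-injective (x ∷ xs) (x∉xs ∷ _) (suc j) zero     e = ⊥-elim (All.lookup x∉xs (∈-lookup j) (sym e))
lookup-injective (x ∷ xs) (_ ∷ uniq) (suc j) (suc j') e = cong suc (lookup-injective xs uniq j j' e)

columnsOf-distinct : ∀ {m} (C : List (Column m)) → Unique C →
  ∀ j j' → (∀ i → columnsOf C i j ≡ columnsOf C i j') → j ≡ j'
columnsOf-distinct C uniq j j' same = lookup-injective C uniq j j' (column-ext same)

-- A row permutation σ
-- preserving the matrix permutes C, hence R; preserving weights it fixes every
-- member of R, so by separation σ = id, and then τ = id as columns are distinct.
matrixRigid-by-complement : ∀ {m} (R C : List (Column m)) → Unique C →
  (∀ v → v ∉ R → v ∈ C) → (∀ v → v ∈ C → v ∉ R) →
  (∀ v w → v ∈ R → w ∈ R → weight v ≡ weight w → v ≡ w) →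
  (∀ i i' → (∀ v → v ∈ R → lookup v i ≡ lookup v i') → i ≡ i') →
  MatrixRigid (columnsOf C)
matrixRigid-by-complement {m} R C uniqC outsideR⇒C C⇒outsideR weightsDistinct separates σ τ preserved =
  σ-id , τ-id
  where
    open Inverse σ using (to; from; strictlyInverseˡ)
    open DecMembership (Vecₚ.≡-dec {n = m} Bool._≟_) using (_∈?_)
    col : Fin (length C) → Column m
    col = L.lookup C

    permuteRows : Column m → Column m
    permuteRows v = tabulate (λ i → lookup v (to i))

    lookup-permuteRows : ∀ v i → lookup (permuteRows v) i ≡ lookup v (to i)
    lookup-permuteRows v i = lookup∘tabulate _ i

    permuteRows-col : ∀ j → permuteRows (col (Inverse.to τ j)) ≡ col j
    permuteRows-col j = column-ext (λ i → trans (lookup-permuteRows (col (Inverse.to τ j)) i) (preserved i j))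

    permuteRows-injective : ∀ {v w} → permuteRows v ≡ permuteRows w → v ≡ w
    permuteRows-injective {v} {w} e = column-ext λ i → begin
      lookup v i                          ≡⟨ cong (lookup v) (strictlyInverseˡ i) ⟨
      lookup v (to (from i))              ≡⟨ lookup-permuteRows v (from i) ⟨
      lookup (permuteRows v) (from i)     ≡⟨ cong (λ x → lookup x (from i)) e ⟩
      lookup (permuteRows w) (from i)     ≡⟨ lookup-permuteRows w (from i) ⟩
      lookup w (to (from i))              ≡⟨ cong (lookup w) (strictlyInverseˡ i) ⟩
      lookup w i                          ∎
      where open ≡-Reasoning

    -- If permuteRows v were outside R it would be a column, and so would v.
    permuteRows-R : ∀ v → v ∈ R → permuteRows v ∈ R
    permuteRows-R v v∈R with permuteRows v ∈? R
    ... | yes p = p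
    ... | no p∉R = ⊥-elim (C⇒outsideR v v∈C v∈R)
      where
        j : Fin (length C)
        j = Any.index (outsideR⇒C (permuteRows v) p∉R)
        v∈C : v ∈ C
        v∈C = subst (_∈ C) (permuteRows-injective (trans (permuteRows-col j) (sym (lookup-index (outsideR⇒C (permuteRows v) p∉R)))))
                (∈-lookup (Inverse.to τ j))

    weight-permuteRows : ∀ v → weight (permuteRows v) ≡ weight v
    weight-permuteRows v = trans (sum-cong-≗ (λ i → cong bit (lookup-permuteRows v i)))
                                 (sym (sum-permute (λ i → bit (lookup v i)) σ))

    permuteRows-fixes-R : ∀ v → v ∈ R → permuteRows v ≡ v
    permuteRows-fixes-R v v∈R = weightsDistinct (permuteRows v) v (permuteRows-R v v∈R) v∈R (weight-permuteRows v)

    σ-id : ∀ i → to i ≡ i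
    σ-id i = separates (to i) i (λ v v∈R →
      trans (sym (lookup-permuteRows v i)) (cong (λ x → lookup x i) (permuteRows-fixes-R v v∈R)))

    permuteRows-id : ∀ v → permuteRows v ≡ v
    permuteRows-id v = column-ext (λ i → trans (lookup-permuteRows v i) (cong (lookup v) (σ-id i)))

    τ-id : ∀ j → Inverse.to τ j ≡ j
    τ-id j = lookup-injective C uniqC (Inverse.to τ j) j
      (trans (sym (permuteRows-id (col (Inverse.to τ j)))) (permuteRows-col j))

allColumns : (m : ℕ) → List (Column m)
allColumns zero    = [] ∷ []
allColumns (suc m) = L.map (false ∷_) (allColumns m) ++ L.map (true ∷_) (allColumns m)

allColumns-complete : ∀ {m} (v : Column m) → v ∈ allColumns m
allColumns-complete []                = here refl
allColumns-complete {suc m} (false ∷ v) = ∈-++⁺ˡ (∈-map⁺ (false ∷_) (allColumns-complete v))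
allColumns-complete {suc m} (true ∷ v)  = ∈-++⁺ʳ (L.map (false ∷_) (allColumns m)) (∈-map⁺ (true ∷_) (allColumns-complete v))

allColumns-unique : ∀ m → Unique (allColumns m)
allColumns-unique zero    = [] ∷ []
allColumns-unique (suc m) = Unique.++⁺ (Unique.map⁺ (proj₂ ∘ Vecₚ.∷-injective) (allColumns-unique m))
                                       (Unique.map⁺ (proj₂ ∘ Vecₚ.∷-injective) (allColumns-unique m))
                                       heads-differ
  where
    heads-differ : ∀ {v} → ¬ (v ∈ L.map (false ∷_) (allColumns m) × v ∈ L.map (true ∷_) (allColumns m))
    heads-differ (p , q) with ∈-map⁻ (false ∷_) p | ∈-map⁻ (true ∷_) q
    ... | _ , _ , refl | _ , _ , ()

allColumns-length : ∀ m → length (allColumns m) ≡ 2 ^ m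
allColumns-length zero    = refl
allColumns-length (suc m) = begin
  length (L.map (false ∷_) (allColumns m) ++ L.map (true ∷_) (allColumns m))
    ≡⟨ length-++ (L.map (false ∷_) (allColumns m)) ⟩
  length (L.map (false ∷_) (allColumns m)) + length (L.map (true ∷_) (allColumns m))
    ≡⟨ cong₂ _+_ (length-map _ (allColumns m)) (length-map _ (allColumns m)) ⟩
  length (allColumns m) + length (allColumns m)
    ≡⟨ cong (λ x → x + x) (allColumns-length m) ⟩
  2 ^ m + 2 ^ m
    ≡⟨ cong (2 ^ m +_) (+-identityʳ (2 ^ m)) ⟨
  2 ^ suc m ∎
  where open ≡-Reasoning

length-filter-split : ∀ {A : Set} {P : A → Set} (P? : Decidable P) (xs : List A) →
  length (L.filter P? xs) + length (L.filter (¬? ∘ P?) xs) ≡ length xs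
length-filter-split P? [] = refl
length-filter-split P? (x ∷ xs) with P? x
... | yes _ = cong suc (length-filter-split P? xs)
... | no  _ = trans (+-suc _ _) (cong suc (length-filter-split P? xs))

unique-same-length : ∀ {A : Set} {xs ys : List A} → Unique xs → Unique ys →
  (∀ {x} → x ∈ xs ⇔ x ∈ ys) → length xs ≡ length ys
unique-same-length uxs uys same = ↭-length (∼bag⇒↭ (unique∧set⇒bag uxs uys same))

module Outside {m : ℕ} (R : List (Column m)) where
  open DecMembership (Vecₚ.≡-dec {n = m} Bool._≟_) using (_∈?_)

  outside : List (Column m)
  outside = L.filter (λ v → ¬? (v ∈? R)) (allColumns m)

  ∈-outside⁺ : ∀ {v} → v ∉ R → v ∈ outside
  ∈-outside⁺ {v} v∉R = ∈-filter⁺ (λ v → ¬? (v ∈? R)) (allColumns-complete v) v∉R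

  ∈-outside⁻ : ∀ {v} → v ∈ outside → v ∉ R
  ∈-outside⁻ p = proj₂ (∈-filter⁻ (λ v → ¬? (v ∈? R)) {xs = allColumns m} p)

  outside-unique : Unique outside
  outside-unique = Unique.filter⁺ (λ v → ¬? (v ∈? R)) (allColumns-unique m)

  length-outside : Unique R → length outside + length R ≡ 2 ^ m
  length-outside uniqR = begin
    length outside + length R
      ≡⟨ +-comm (length outside) (length R) ⟩
    length R + length outside
      ≡⟨ cong (_+ length outside) (unique-same-length uniqR (Unique.filter⁺ _ (allColumns-unique m)) inR⇔) ⟩
    length (L.filter (_∈? R) (allColumns m)) + length outside
      ≡⟨ length-filter-split (_∈? R) (allColumns m) ⟩
    length (allColumns m)
      ≡⟨ allColumns-length m ⟩
    2 ^ m ∎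
    where
      open ≡-Reasoning
      inR⇔ : ∀ {v} → v ∈ R ⇔ v ∈ L.filter (_∈? R) (allColumns m)
      inR⇔ {v} = mk⇔ (∈-filter⁺ (_∈? R) (allColumns-complete v)) (proj₂ ∘ ∈-filter⁻ (_∈? R) {xs = allColumns m})

ones : ∀ {m} → Fin m → List (Column m) → ℕ
ones i []      = 0
ones i (v ∷ C) = bit (lookup v i) + ones i C

outDegree-columnsOf : ∀ {m} (C : List (Column m)) i → outDegree (columnsOf C) i ≡ ones i C
outDegree-columnsOf []      i = refl
outDegree-columnsOf (v ∷ C) i = cong (bit (lookup v i) +_) (outDegree-columnsOf C i)

ones-++ : ∀ {m} (i : Fin m) C D → ones i (C ++ D) ≡ ones i C + ones i D
ones-++ i []      D = refl
ones-++ i (v ∷ C) D = trans (cong (bit (lookup v i) +_) (ones-++ i C D)) (sym (+-assoc (bit (lookup v i)) _ _))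

matrixRigid-by-staggered-rows : ∀ {m} (C : List (Column m)) (c : ℕ) → Unique C →
  (∀ i → ones i C ≡ toℕ i + c) → MatrixRigid (columnsOf C)
matrixRigid-by-staggered-rows C c uniq staggered =
  matrixRigid-by-degrees (columnsOf C) rowsDistinct (columnsOf-distinct C uniq)
  where
    rowsDistinct : ∀ i i' → outDegree (columnsOf C) i ≡ outDegree (columnsOf C) i' → i ≡ i'
    rowsDistinct i i' e = toℕ-injective (+-cancelʳ-≡ c (toℕ i) (toℕ i') (begin
      toℕ i + c                 ≡⟨ staggered i ⟨
      ones i C                  ≡⟨ outDegree-columnsOf C i ⟨
      outDegree (columnsOf C) i  ≡⟨ e ⟩
      outDegree (columnsOf C) i' ≡⟨ outDegree-columnsOf C i' ⟩
      ones i' C                 ≡⟨ staggered i' ⟩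
      toℕ i' + c                ∎))
      where open ≡-Reasoning

-- Row counts are read off from
-- two building blocks: a staircase, whose rows have 1, 2, ..., m ones, and
-- complementary pairs, which add the same number of ones to every row.

staircase : (m : ℕ) → List (Column m)
staircase zero    = [] ∷ []
staircase (suc m) = Vec.replicate (suc m) true ∷ L.map (false ∷_) (staircase m)

ones-prefix-false : ∀ {m} (i : Fin m) C → ones (suc i) (L.map (false ∷_) C) ≡ ones i C
ones-prefix-false i []      = refl
ones-prefix-false i (v ∷ C) = cong (bit (lookup v i) +_) (ones-prefix-false i C)

ones-prefix-false-top : ∀ {m} (C : List (Column m)) → ones zero (L.map (false ∷_) C) ≡ 0
ones-prefix-false-top []      = refl
ones-prefix-false-top (v ∷ C) = ones-prefix-false-top C

ones-staircase : ∀ m (i : Fin m) → ones i (staircase m) ≡ suc (toℕ i)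
ones-staircase (suc m) zero    = cong suc (ones-prefix-false-top (staircase m))
ones-staircase (suc m) (suc i) = cong₂ _+_ (cong bit (Vecₚ.lookup-replicate i true))
                                           (trans (ones-prefix-false i (staircase m)) (ones-staircase m i))

ones-lowered-staircase : ∀ m (i : Fin (suc m)) → ones i (L.map (false ∷_) (staircase m)) ≡ toℕ i
ones-lowered-staircase m zero    = ones-prefix-false-top (staircase m)
ones-lowered-staircase m (suc i) = trans (ones-prefix-false i (staircase m)) (ones-staircase m i)

staircase-length : ∀ m → length (staircase m) ≡ suc m
staircase-length zero    = refl
staircase-length (suc m) = cong suc (trans (length-map _ (staircase m)) (staircase-length m))

-- The top bit separates 1^(m+1) from the lowered columns.
staircase-unique : ∀ m → Unique (staircase m)
staircase-unique zero    = [] ∷ []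
staircase-unique (suc m) =
  All.tabulate (λ p → all-ones-not-lowered (∈-map⁻ (false ∷_) p)) ∷ Unique.map⁺ (proj₂ ∘ Vecₚ.∷-injective) (staircase-unique m)
  where
    all-ones-not-lowered : ∀ {v} → Σ (Column m) (λ w → w ∈ staircase m × v ≡ false ∷ w) → Vec.replicate (suc m) true ≢ v
    all-ones-not-lowered (_ , _ , refl) ()

zeros∈staircase : ∀ m → Vec.replicate m false ∈ staircase m
zeros∈staircase zero    = here refl
zeros∈staircase (suc m) = there (∈-map⁺ (false ∷_) (zeros∈staircase m))

invert : ∀ {m} → Column m → Column m
invert = Vec.map not

invert-involutive : ∀ {m} (w : Column m) → invert (invert w) ≡ w
invert-involutive w = trans (sym (Vecₚ.map-∘ not not w)) (trans (Vecₚ.map-cong not-involutive w) (Vecₚ.map-id w))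

-- Each column w yields the pair 0w, 1w̄, contributing exactly one 1 to every row.
pairUp : ∀ {m} → List (Column m) → List (Column (suc m))
pairUp []       = []
pairUp (w ∷ ws) = (false ∷ w) ∷ (true ∷ invert w) ∷ pairUp ws

pairUp-length : ∀ {m} (ws : List (Column m)) → length (pairUp ws) ≡ length ws + length ws
pairUp-length []       = refl
pairUp-length (w ∷ ws) = cong suc (trans (cong suc (pairUp-length ws)) (sym (+-suc (length ws) (length ws))))

ones-pairUp : ∀ {m} (i : Fin (suc m)) (ws : List (Column m)) → ones i (pairUp ws) ≡ length ws
ones-pairUp i       []       = refl
ones-pairUp zero    (w ∷ ws) = cong suc (ones-pairUp zero ws)
ones-pairUp (suc i) (w ∷ ws) = begin
  bit (lookup w i) + (bit (lookup (invert w) i) + ones (suc i) (pairUp ws))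
    ≡⟨ +-assoc (bit (lookup w i)) _ _ ⟨
  bit (lookup w i) + bit (lookup (invert w) i) + ones (suc i) (pairUp ws)
    ≡⟨ cong₂ _+_ (trans (cong (λ b → bit (lookup w i) + bit b) (Vecₚ.lookup-map i not w)) (one-of-pair (lookup w i)))
                 (ones-pairUp (suc i) ws) ⟩
  suc (length ws) ∎
  where
    open ≡-Reasoning
    one-of-pair : ∀ b → bit b + bit (not b) ≡ 1
    one-of-pair true  = refl
    one-of-pair false = refl

∈-pairUp⁻ : ∀ {m} {v : Column (suc m)} ws → v ∈ pairUp ws →
  Σ (Column m) λ w → w ∈ ws × (v ≡ false ∷ w ⊎ v ≡ true ∷ invert w)
∈-pairUp⁻ (w ∷ ws) (here e)         = w , here refl , inj₁ e
∈-pairUp⁻ (w ∷ ws) (there (here e)) = w , here refl , inj₂ e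
∈-pairUp⁻ (w ∷ ws) (there (there p)) with ∈-pairUp⁻ ws p
... | x , x∈ws , shape = x , there x∈ws , shape

-- Distinct columns give distinct pairs, and 0w ≠ 1x̄ by their top bits.
pairUp-unique : ∀ {m} (ws : List (Column m)) → Unique ws → Unique (pairUp ws)
pairUp-unique []       []            = []
pairUp-unique (w ∷ ws) (w∉ws ∷ uniq) =
  ((λ ()) ∷ All.tabulate (λ p → zero-first (∈-pairUp⁻ ws p))) ∷
  All.tabulate (λ p → one-first (∈-pairUp⁻ ws p)) ∷ pairUp-unique ws uniq
  where
    zero-first : ∀ {v} → Σ (Column _) (λ x → x ∈ ws × (v ≡ false ∷ x ⊎ v ≡ true ∷ invert x)) → false ∷ w ≢ v
    zero-first (x , x∈ws , inj₁ refl) e = All.lookup w∉ws x∈ws (proj₂ (Vecₚ.∷-injective e))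
    zero-first (x , x∈ws , inj₂ refl) ()
    one-first : ∀ {v} → Σ (Column _) (λ x → x ∈ ws × (v ≡ false ∷ x ⊎ v ≡ true ∷ invert x)) → true ∷ invert w ≢ v
    one-first (x , x∈ws , inj₁ refl) ()
    one-first (x , x∈ws , inj₂ refl) e = All.lookup w∉ws x∈ws (begin
      w             ≡⟨ invert-involutive w ⟨
      invert (invert w) ≡⟨ cong invert (proj₂ (Vecₚ.∷-injective e)) ⟩
      invert (invert x) ≡⟨ invert-involutive x ⟩
      x             ∎)
      where open ≡-Reasoning

∈-take⁻ : ∀ {A : Set} {x : A} q xs → x ∈ L.take q xs → x ∈ xs
∈-take⁻ (suc q) (y ∷ xs) (here e) = here e
∈-take⁻ (suc q) (y ∷ xs) (there p) = there (∈-take⁻ q xs p)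

-- With m+1 rows: the lowered staircase followed by q complementary pairs of
-- columns off the staircase gives m+1+2q columns with i+q ones in row i;
-- adding the all-ones column gives one more column and one more one per row.
module FewColumns (m : ℕ) where
  open Outside (staircase m) public using () renaming (outside to fresh)
  open Outside (staircase m) using (length-outside) renaming (∈-outside⁻ to ∈-fresh⁻; outside-unique to fresh-unique)

  fresh-count : length fresh + suc m ≡ 2 ^ m
  fresh-count = trans (cong (length fresh +_) (sym (staircase-length m))) (length-outside (staircase-unique m))

  pairs : ℕ → List (Column (suc m))
  pairs q = pairUp (L.take q fresh)

  evenColumns : ℕ → List (Column (suc m))
  evenColumns q = L.map (false ∷_) (staircase m) ++ pairs q

  oddColumns : ℕ → List (Column (suc m))
  oddColumns q = Vec.replicate (suc m) true ∷ evenColumns q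

  pairs-unique : ∀ q → Unique (pairs q)
  pairs-unique q = pairUp-unique _ (Unique.take⁺ q fresh-unique)

  -- The paired columns w are off the staircase, and 1w̄ starts with a one.
  lowered-staircase-disjoint-pairs : ∀ q {v} → ¬ (v ∈ L.map (false ∷_) (staircase m) × v ∈ pairs q)
  lowered-staircase-disjoint-pairs q (p , p') with ∈-map⁻ (false ∷_) p | ∈-pairUp⁻ (L.take q fresh) p'
  ... | s , s∈staircase , refl | w , w∈pairs , inj₁ e =
    ∈-fresh⁻ (∈-take⁻ q fresh w∈pairs) (subst (_∈ staircase m) (proj₂ (Vecₚ.∷-injective e)) s∈staircase)
  ... | s , s∈staircase , refl | w , w∈pairs , inj₂ ()

  -- 1^(m+1) = 1w̄ would force w = 0^m, which lies on the staircase.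
  all-ones∉evenColumns : ∀ q → Vec.replicate (suc m) true ∉ evenColumns q
  all-ones∉evenColumns q p with ∈-++⁻ (L.map (false ∷_) (staircase m)) p
  ... | inj₁ p₁ with ∈-map⁻ (false ∷_) p₁
  ...   | _ , _ , ()
  all-ones∉evenColumns q p | inj₂ p₂ with ∈-pairUp⁻ (L.take q fresh) p₂
  ...   | w , w∈pairs , inj₁ ()
  ...   | w , w∈pairs , inj₂ e = ∈-fresh⁻ (∈-take⁻ q fresh w∈pairs) (subst (_∈ staircase m) w≡zeros (zeros∈staircase m))
    where
      w≡zeros : Vec.replicate m false ≡ w
      w≡zeros = begin
        Vec.replicate m false          ≡⟨ Vecₚ.map-replicate not true m ⟨
        invert (Vec.replicate m true)    ≡⟨ cong invert (proj₂ (Vecₚ.∷-injective e)) ⟩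
        invert (invert w)                  ≡⟨ invert-involutive w ⟩
        w                              ∎
        where open ≡-Reasoning

  evenColumns-unique : ∀ q → Unique (evenColumns q)
  evenColumns-unique q = Unique.++⁺ (Unique.map⁺ (proj₂ ∘ Vecₚ.∷-injective) (staircase-unique m)) (pairs-unique q)
                                    (lowered-staircase-disjoint-pairs q)

  ones-evenColumns : ∀ q i → ones i (evenColumns q) ≡ toℕ i + length (L.take q fresh)
  ones-evenColumns q i = trans (ones-++ i (L.map (false ∷_) (staircase m)) (pairs q))
                               (cong₂ _+_ (ones-lowered-staircase m i) (ones-pairUp i (L.take q fresh)))

  evenColumns-rigid : ∀ q → MatrixRigid (columnsOf (evenColumns q))
  evenColumns-rigid q = matrixRigid-by-staggered-rows (evenColumns q) _ (evenColumns-unique q) (ones-evenColumns q)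

  oddColumns-rigid : ∀ q → MatrixRigid (columnsOf (oddColumns q))
  oddColumns-rigid q = matrixRigid-by-staggered-rows (oddColumns q) _
    (All.tabulate (λ p e → all-ones∉evenColumns q (subst (_∈ evenColumns q) (sym e) p)) ∷ evenColumns-unique q)
    (λ i → begin
      bit (lookup (Vec.replicate (suc m) true) i) + ones i (evenColumns q)
        ≡⟨ cong₂ _+_ (cong bit (Vecₚ.lookup-replicate i true)) (ones-evenColumns q i) ⟩
      suc (toℕ i + length (L.take q fresh))
        ≡⟨ +-suc (toℕ i) _ ⟨
      toℕ i + suc (length (L.take q fresh)) ∎)
    where open ≡-Reasoning

  length-take-fresh : ∀ q → q ≤ length fresh → length (L.take q fresh) ≡ q
  length-take-fresh q q≤ = trans (length-take q fresh) (m≤n⇒m⊓n≡m q≤)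

  evenColumns-length : ∀ q → q ≤ length fresh → length (evenColumns q) ≡ suc m + (q + q)
  evenColumns-length q q≤ = begin
    length (evenColumns q)
      ≡⟨ length-++ (L.map (false ∷_) (staircase m)) ⟩
    length (L.map (false ∷_) (staircase m)) + length (pairs q)
      ≡⟨ cong₂ _+_ (trans (length-map _ (staircase m)) (staircase-length m)) (pairUp-length (L.take q fresh)) ⟩
    suc m + (length (L.take q fresh) + length (L.take q fresh))
      ≡⟨ cong (λ x → suc m + (x + x)) (length-take-fresh q q≤) ⟩
    suc m + (q + q) ∎
    where open ≡-Reasoning

halve : ∀ d → Σ ℕ λ q → d ≡ q + q ⊎ d ≡ suc (q + q)
halve zero = 0 , inj₁ refl
halve (suc d) with halve d
... | q , inj₁ e = q , inj₂ (cong suc e)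
... | q , inj₂ e = suc q , inj₁ (trans (cong suc e) (cong suc (sym (+-suc q q))))

half-≤ : ∀ q F → q + q ≤ suc (F + F) → q ≤ F
half-≤ q F le = ≮⇒≥ λ F<q → <⇒≱ (≤-trans (≤-reflexive (cong suc (sym (+-suc F F)))) (+-mono-≤ F<q F<q)) le

MatrixRigidOrientation : ℕ → ℕ → Set
MatrixRigidOrientation m n = Σ (Orientation m n) MatrixRigid

fromColumns : ∀ {m n} (C : List (Column m)) → length C ≡ n → MatrixRigid (columnsOf C) → MatrixRigidOrientation m n
fromColumns C refl rigid = columnsOf C , rigid

-- Few columns: for m+1 < n ≤ 2^(m+1) - m there is a matrix-rigid
-- orientation of K_{m+1,n}, with 2q or 2q+1 columns beyond the first m+1.
fewColumns : ∀ m n → suc m < n → n + m ≤ 2 ^ suc m → MatrixRigidOrientation (suc m) n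
fewColumns m n lo hi = build (halve d)
  where
    open FewColumns m
    F d : ℕ
    F = length fresh
    d = n ∸ suc m

    n≡ : suc m + d ≡ n
    n≡ = m+[n∸m]≡n (<⇒≤ lo)

    -- n + m ≤ 2^(m+1) = 2(F + m + 1) means d ≤ 2F + 1.
    d≤ : d ≤ suc (F + F)
    d≤ = +-cancelʳ-≤ (suc m + m) d (suc (F + F)) (begin
      d + (suc m + m)             ≡⟨ regroup d m ⟩
      suc m + d + m               ≡⟨ cong (_+ m) n≡ ⟩
      n + m                       ≤⟨ hi ⟩
      2 ^ m + (2 ^ m + 0)         ≡⟨ cong (λ x → x + (x + 0)) fresh-count ⟨
      F + suc m + (F + suc m + 0) ≡⟨ rearrange F m ⟩
      suc (F + F) + (suc m + m)   ∎)
      where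
        open ≤-Reasoning
        regroup : ∀ d m → d + (suc m + m) ≡ suc m + d + m
        regroup = solve-∀
        rearrange : ∀ F m → F + suc m + (F + suc m + 0) ≡ suc (F + F) + (suc m + m)
        rearrange = solve-∀

    build : (Σ ℕ λ q → d ≡ q + q ⊎ d ≡ suc (q + q)) → MatrixRigidOrientation (suc m) n
    build (q , inj₁ even) = fromColumns (evenColumns q)
      (trans (evenColumns-length q q≤F) (trans (cong (suc m +_) (sym even)) n≡))
      (evenColumns-rigid q)
      where
        q≤F : q ≤ F
        q≤F = half-≤ q F (≤-trans (≤-reflexive (sym even)) d≤)
    build (q , inj₂ odd) = fromColumns (oddColumns q)
      (trans (cong suc (evenColumns-length q q≤F)) (trans (sym (+-suc (suc m) (q + q))) (trans (cong (suc m +_) (sym odd)) n≡)))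
      (oddColumns-rigid q)
      where
        q≤F : q ≤ F
        q≤F = half-≤ q F (≤-trans (n≤1+n (q + q)) (≤-trans (≤-reflexive (sym odd)) d≤))

bitAt : List Bool → ℕ → Bool
bitAt []      _       = false
bitAt (b ∷ l) zero    = b
bitAt (b ∷ l) (suc x) = bitAt l x

pad : (m : ℕ) → List Bool → Column m
pad zero    _       = []
pad (suc m) []      = false ∷ pad m []
pad (suc m) (b ∷ l) = b ∷ pad m l

lookup-pad : ∀ m l (i : Fin m) → lookup (pad m l) i ≡ bitAt l (toℕ i)
lookup-pad (suc m) []      zero    = refl
lookup-pad (suc m) []      (suc i) = lookup-pad m [] i
lookup-pad (suc m) (b ∷ l) zero    = refl
lookup-pad (suc m) (b ∷ l) (suc i) = lookup-pad m l i

onesIn : List Bool → ℕ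
onesIn []      = 0
onesIn (b ∷ l) = bit b + onesIn l

weight-pad : ∀ m l → length l ≤ m → weight (pad m l) ≡ onesIn l
weight-pad zero    []      _         = refl
weight-pad (suc m) []      _         = weight-pad m [] z≤n
weight-pad (suc m) (b ∷ l) (s≤s l≤m) = cong (bit b +_) (weight-pad m l l≤m)

true≢false : true ≢ false
true≢false ()

bitAt-beyond : ∀ l x → length l ≤ x → bitAt l x ≡ false
bitAt-beyond []      x       _         = refl
bitAt-beyond (b ∷ l) (suc x) (s≤s l≤x) = bitAt-beyond l x l≤x

run : ℕ → List Bool
run k = L.replicate k true

onesIn-run : ∀ k → onesIn (run k) ≡ k
onesIn-run zero    = refl
onesIn-run (suc k) = cong suc (onesIn-run k)

onesIn-run++ : ∀ k r → onesIn (run k ++ r) ≡ k + onesIn r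
onesIn-run++ zero    r = refl
onesIn-run++ (suc k) r = cong suc (onesIn-run++ k r)

length-run++ : ∀ k r → length (run k ++ r) ≡ k + length r
length-run++ k r = trans (length-++ (run k)) (cong (_+ length r) (length-replicate k))

bitAt-run : ∀ k r x → x < k → bitAt (run k ++ r) x ≡ true
bitAt-run (suc k) r zero    _         = refl
bitAt-run (suc k) r (suc x) (s≤s x<k) = bitAt-run k r x x<k

bitAt-after-run : ∀ k r z → bitAt (run k ++ r) (k + z) ≡ bitAt r z
bitAt-after-run zero    r z = refl
bitAt-after-run (suc k) r z = bitAt-after-run k r z

increasing⇒injective : ∀ {n} (h : ℕ → ℕ) → (∀ {i j} → i < j → j < n → h i < h j) →
  ∀ {i j} → i < n → j < n → h i ≡ h j → i ≡ j
increasing⇒injective h increasing {i} {j} i<n j<n e with <-cmp i j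
... | tri< i<j _ _ = ⊥-elim (<-irrefl e (increasing i<j j<n))
... | tri≈ _ i≡j _ = i≡j
... | tri> _ _ j<i = ⊥-elim (<-irrefl (sym e) (increasing j<i i<n))

-- Two indexed families f(0..H-1) and g(0..E-1) told apart by a numerical
-- invariant w, which increases strictly along each family and never takes the
-- same value on both: the concatenated list has no repetition and w is
-- injective on its members.
module TwoFamilies {A : Set} (w : A → ℕ) (f g : ℕ → A) (H E : ℕ)
  (f-increasing : ∀ {a b} → a < b → b < H → w (f a) < w (f b))
  (g-increasing : ∀ {s t} → s < t → t < E → w (g s) < w (g t))
  (f≢g : ∀ {a t} → a < H → t < E → w (f a) ≢ w (g t)) where

  family : List A
  family = L.applyUpTo f H ++ L.applyUpTo g E

  family-length : length family ≡ H + E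
  family-length = trans (length-++ (L.applyUpTo f H)) (cong₂ _+_ (length-applyUpTo f H) (length-applyUpTo g E))

  ∈-family⁻ : ∀ {x} → x ∈ family → (Σ ℕ λ a → a < H × x ≡ f a) ⊎ (Σ ℕ λ t → t < E × x ≡ g t)
  ∈-family⁻ p with ∈-++⁻ (L.applyUpTo f H) p
  ... | inj₁ q = inj₁ (∈-applyUpTo⁻ f q)
  ... | inj₂ q = inj₂ (∈-applyUpTo⁻ g q)

  w-injective : ∀ {x y} → x ∈ family → y ∈ family → w x ≡ w y → x ≡ y
  w-injective p q e with ∈-family⁻ p | ∈-family⁻ q
  ... | inj₁ (a , a<H , refl) | inj₁ (b , b<H , refl) = cong f (increasing⇒injective (w ∘ f) f-increasing a<H b<H e)
  ... | inj₁ (a , a<H , refl) | inj₂ (t , t<E , refl) = ⊥-elim (f≢g a<H t<E e)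
  ... | inj₂ (t , t<E , refl) | inj₁ (a , a<H , refl) = ⊥-elim (f≢g a<H t<E (sym e))
  ... | inj₂ (s , s<E , refl) | inj₂ (t , t<E , refl) = cong g (increasing⇒injective (w ∘ g) g-increasing s<E t<E e)

  family-unique : Unique family
  family-unique = Unique.++⁺
    (Unique.applyUpTo⁺₁ f H (λ a<b b<H e → <-irrefl (cong w e) (f-increasing a<b b<H)))
    (Unique.applyUpTo⁺₁ g E (λ s<t t<E e → <-irrefl (cong w e) (g-increasing s<t t<E)))
    (λ (p , q) → let (a , a<H , e₁) = ∈-applyUpTo⁻ f p ; (t , t<E , e₂) = ∈-applyUpTo⁻ g q in
                 f≢g a<H t<E (cong w (trans (sym e₁) e₂)))

odd≢even : ∀ x y → suc (x + x) ≢ y + y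
odd≢even x       zero    ()
odd≢even zero    (suc y) e with () ← trans (suc-injective e) (+-suc y y)
odd≢even (suc x) (suc y) e =
  odd≢even x y (suc-injective (trans (sym (+-suc (suc x) x)) (trans (suc-injective e) (+-suc y y))))

double-injective : ∀ x y → x + x ≡ y + y → x ≡ y
double-injective x y = increasing⇒injective {n = suc (x + y)} (λ z → z + z) (λ i<j _ → +-mono-< i<j i<j)
  (s≤s (m≤m+n x y)) (s≤s (m≤n+m y x))

double-<⁻ : ∀ x y → x + x < y + y → x < y
double-<⁻ x y lt = ≰⇒> λ y≤x → <⇒≱ lt (+-mono-≤ y≤x y≤x)

module ManyColumns (m H E : ℕ) (3≤H : 3 ≤ H) (m≤2H : m ≤ H + H) (2H≤1+m : H + H ≤ suc m) (E+2≤H : E + 2 ≤ H) where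

  -- The base column Q_a has ones in rows 0..2a-2, 2a and, unless a = H-1, 2a+1.
  ending : ℕ → List Bool
  ending a = if suc a <ᵇ H then true ∷ [] else []

  baseString : ℕ → List Bool
  baseString zero    = true ∷ true ∷ []
  baseString (suc c) = run (suc (c + c)) ++ false ∷ true ∷ ending (suc c)

  data Ending (a : ℕ) : Set where
    notLast : suc a < H → ending a ≡ true ∷ [] → Ending a
    isLast  : ¬ suc a < H → ending a ≡ [] → Ending a

  ending-cases : ∀ a → Ending a
  ending-cases a with suc a <ᵇ H in eq
  ... | true  = notLast (<ᵇ⇒< (suc a) H (subst T (sym eq) tt)) (cong (λ b → if b then true ∷ [] else []) eq)
  ... | false = isLast (λ a+1<H → subst T eq (<⇒<ᵇ a+1<H)) (cong (λ b → if b then true ∷ [] else []) eq)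

  ending-length : ∀ a → length (ending a) ≤ 1
  ending-length a with ending-cases a
  ... | notLast _ e = subst (λ l → length l ≤ 1) (sym e) ≤-refl
  ... | isLast  _ e = subst (λ l → length l ≤ 1) (sym e) z≤n

  ending-ones : ∀ a → onesIn (ending a) ≤ 1
  ending-ones a with ending-cases a
  ... | notLast _ e = subst (λ l → onesIn l ≤ 1) (sym e) ≤-refl
  ... | isLast  _ e = subst (λ l → onesIn l ≤ 1) (sym e) z≤n

  -- Every row r < m satisfies r + 1 ≤ 2H - 1, so doubled indices below H fit.
  double-fits : ∀ x → x < H → suc (x + x) ≤ m
  double-fits x x<H = ≤-pred (≤-trans (≤-reflexive (cong suc (sym (+-suc x x)))) (≤-trans (+-mono-≤ x<H x<H) 2H≤1+m))

  1<H : 1 < H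
  1<H = ≤-trans (s≤s (s≤s z≤n)) 3≤H

  -- Weights of the base columns: Q_0 has weight 2, Q_a (a ≥ 1) weight 2a or 2a+1.
  baseWeight : ℕ → ℕ
  baseWeight a = onesIn (baseString a)

  -- Q_(c+1) has weight 2c+2 plus its ending, so weights increase strictly with a.
  baseWeight-suc : ∀ c → baseWeight (suc c) ≡ suc c + suc c + onesIn (ending (suc c))
  baseWeight-suc c = trans (onesIn-run++ (suc (c + c)) (false ∷ true ∷ ending (suc c))) (regroup c _)
    where
      regroup : ∀ c x → suc (c + c) + suc x ≡ suc c + suc c + x
      regroup = solve-∀

  baseWeight-lower : ∀ c → suc c + suc c ≤ baseWeight (suc c)
  baseWeight-lower c = ≤-trans (m≤m+n _ _) (≤-reflexive (sym (baseWeight-suc c)))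

  baseWeight-upper : ∀ c → baseWeight (suc c) ≤ suc (suc c + suc c)
  baseWeight-upper c = ≤-trans (≤-reflexive (baseWeight-suc c))
    (≤-trans (+-monoʳ-≤ (suc c + suc c) (ending-ones (suc c))) (≤-reflexive (+-comm _ 1)))

  baseWeight-one : baseWeight 1 ≡ 3
  baseWeight-one with ending-cases 1
  ... | notLast _ e = trans (baseWeight-suc 0) (cong (λ l → 2 + onesIn l) e)
  ... | isLast 2≮H _ = ⊥-elim (2≮H 3≤H)

  baseWeight-increasing : ∀ {a b} → a < b → b < H → baseWeight a < baseWeight b
  baseWeight-increasing {zero}  {suc zero}    _ _ = subst (2 <_) (sym baseWeight-one) ≤-refl
  baseWeight-increasing {zero}  {suc (suc d)} _ _ =
    <-≤-trans (s≤s (s≤s (s≤s z≤n))) (≤-trans (+-mono-≤ (s≤s (s≤s z≤n)) (s≤s (s≤s z≤n))) (baseWeight-lower (suc d)))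
  baseWeight-increasing {suc c} {suc d} (s≤s c<d) _ = begin-strict
    baseWeight (suc c)          ≤⟨ baseWeight-upper c ⟩
    suc (suc c + suc c)         <⟨ ≤-reflexive (cong suc (sym (+-suc (suc c) (suc c)))) ⟩
    suc (suc c) + suc (suc c)   ≤⟨ +-mono-≤ (s≤s c<d) (s≤s c<d) ⟩
    suc d + suc d               ≤⟨ baseWeight-lower d ⟩
    baseWeight (suc d)          ∎
    where open ≤-Reasoning

  extraHalf : ℕ → ℕ
  extraHalf zero    = 0
  extraHalf (suc t) = 2 + t

  extraString : ℕ → List Bool
  extraString t = run (extraHalf t + extraHalf t)

  extraHalf-increasing : ∀ {s t} → s < t → extraHalf s < extraHalf t
  extraHalf-increasing {zero}  {suc t} _         = s≤s z≤n
  extraHalf-increasing {suc s} {suc t} (s≤s s<t) = s≤s (s≤s s<t)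

  -- Extra halves stay below H - 1, so extra weights stay below the last base weight.
  extraHalf-bound : ∀ t → extraHalf t ≤ suc t
  extraHalf-bound zero    = z≤n
  extraHalf-bound (suc t) = ≤-refl

  extraHalf-below : ∀ t → t < E → suc (extraHalf t) < H
  extraHalf-below t t<E = ≤-trans (s≤s (s≤s (extraHalf-bound t))) (≤-trans (≤-reflexive (+-comm 2 _)) (≤-trans (+-monoˡ-≤ 2 t<E) E+2≤H))

  -- An extra weight 2h is never a base weight: not 2 since h ≠ 1, not 2a+1 by
  -- parity, and not 2(H-1) since h ≤ E ≤ H - 2.
  base≢extra : ∀ {a t} → a < H → t < E → baseWeight a ≢ extraHalf t + extraHalf t
  base≢extra {zero} {zero}  _ _ ()
  base≢extra {zero} {suc t} _ _ e with () ← double-injective 1 (2 + t) e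
  base≢extra {suc c} {t} _ t<E e with ending-cases (suc c)
  ... | notLast _ end = odd≢even (suc c) (extraHalf t)
        (trans (trans (+-comm 1 _) (cong (λ l → suc c + suc c + onesIn l) (sym end))) (trans (sym (baseWeight-suc c)) e))
  ... | isLast last end = <-irrefl (sym h≡c+1) (≤-pred (≤-trans (extraHalf-below t t<E) (≮⇒≥ last)))
    where
      h≡c+1 : suc c ≡ extraHalf t
      h≡c+1 = double-injective (suc c) (extraHalf t)
        (trans (sym (+-identityʳ _)) (trans (cong (λ l → suc c + suc c + onesIn l) (sym end)) (trans (sym (baseWeight-suc c)) e)))

  -- The rows of Q_a around 2a: 2a is a one, 2a+1 a one unless a is last,
  -- beyond 2a+1 all zeros; for a = c+1, row 2c is in the initial run and
  -- row 2c+1 is the hole.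
  bit-even : ∀ a → bitAt (baseString a) (a + a) ≡ true
  bit-even zero    = refl
  bit-even (suc c) = trans (cong (bitAt (baseString (suc c))) (regroup c))
                           (bitAt-after-run (suc (c + c)) (false ∷ true ∷ ending (suc c)) 1)
    where
      regroup : ∀ c → suc c + suc c ≡ suc (c + c) + 1
      regroup = solve-∀

  bit-after-even : ∀ a → bitAt (baseString a) (suc (a + a)) ≡ bitAt (ending a) 0
  bit-after-even zero with ending-cases 0
  ... | notLast _ e = cong (λ l → bitAt l 0) (sym e)
  ... | isLast 1≮H _ = ⊥-elim (1≮H 1<H)
  bit-after-even (suc c) = trans (cong (bitAt (baseString (suc c))) (regroup c))
                                 (bitAt-after-run (suc (c + c)) (false ∷ true ∷ ending (suc c)) 2)
    where
      regroup : ∀ c → suc (suc c + suc c) ≡ suc (c + c) + 2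
      regroup = solve-∀

  bit-odd : ∀ a → suc a < H → bitAt (baseString a) (suc (a + a)) ≡ true
  bit-odd a a+1<H with ending-cases a
  ... | notLast _ e    = trans (bit-after-even a) (cong (λ l → bitAt l 0) e)
  ... | isLast a+1≮H _ = ⊥-elim (a+1≮H a+1<H)

  bit-last : ∀ a → ¬ suc a < H → bitAt (baseString a) (suc (a + a)) ≡ false
  bit-last a a+1≮H with ending-cases a
  ... | notLast a+1<H _ = ⊥-elim (a+1≮H a+1<H)
  ... | isLast _ e      = trans (bit-after-even a) (cong (λ l → bitAt l 0) e)

  bit-in-run : ∀ c → bitAt (baseString (suc c)) (c + c) ≡ true
  bit-in-run c = bitAt-run (suc (c + c)) _ (c + c) ≤-refl

  bit-hole : ∀ c → bitAt (baseString (suc c)) (suc (c + c)) ≡ false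
  bit-hole c = trans (cong (bitAt (baseString (suc c))) (sym (+-identityʳ (suc (c + c)))))
                     (bitAt-after-run (suc (c + c)) (false ∷ true ∷ ending (suc c)) 0)

  baseString-length : ∀ a → length (baseString a) ≤ suc (suc (a + a))
  baseString-length zero    = ≤-refl
  baseString-length (suc c) = begin
    length (baseString (suc c))                ≡⟨ length-run++ (suc (c + c)) _ ⟩
    suc (c + c) + suc (suc (length (ending (suc c))))
                                               ≤⟨ +-monoʳ-≤ (suc (c + c)) (s≤s (s≤s (ending-length (suc c)))) ⟩
    suc (c + c) + 3                            ≡⟨ regroup c ⟩
    suc (suc (suc c + suc c))                  ∎
    where
      open ≤-Reasoning
      regroup : ∀ c → suc (c + c) + 3 ≡ suc (suc (suc c + suc c))
      regroup = solve-∀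

  bit-beyond : ∀ a y → suc (suc (a + a)) ≤ y → bitAt (baseString a) y ≡ false
  bit-beyond a y le = bitAt-beyond (baseString a) y (≤-trans (baseString-length a) le)

  baseString-fits : ∀ a → a < H → length (baseString a) ≤ m
  baseString-fits a a<H with ending-cases a
  ... | notLast a+1<H _ = ≤-trans (baseString-length a)
        (≤-trans (s≤s (≤-trans (n≤1+n (suc (a + a))) (≤-reflexive (cong suc (sym (+-suc a a)))))) (double-fits (suc a) a+1<H))
  ... | isLast a+1≮H e = ≤-trans (length-last a a+1≮H e) (double-fits a a<H)
    where
      length-last : ∀ a → ¬ suc a < H → ending a ≡ [] → length (baseString a) ≤ suc (a + a)
      length-last zero    1≮H _ = ⊥-elim (1≮H 1<H)
      length-last (suc c) _   e = ≤-reflexive (begin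
        length (baseString (suc c))              ≡⟨ length-run++ (suc (c + c)) _ ⟩
        suc (c + c) + suc (suc (length (ending (suc c)))) ≡⟨ cong (λ l → suc (c + c) + suc (suc (length l))) e ⟩
        suc (c + c) + 2                          ≡⟨ regroup c ⟩
        suc (suc c + suc c)                      ∎)
        where
          open ≡-Reasoning
          regroup : ∀ c → suc (c + c) + 2 ≡ suc (suc c + suc c)
          regroup = solve-∀

  extraString-fits : ∀ t → t < E → length (extraString t) ≤ m
  extraString-fits t t<E = ≤-trans (≤-reflexive (length-replicate (extraHalf t + extraHalf t)))
    (≤-trans (n≤1+n _) (double-fits (extraHalf t) (<-trans (n<1+n _) (extraHalf-below t t<E))))

  separating : ∀ x y → x < y → y < m → Σ ℕ λ a → a < H × bitAt (baseString a) x ≢ bitAt (baseString a) y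
  separating x y x<y y<m with halve x
  ... | b , inj₂ refl = b , <-trans (n<1+n b) b+1<H , λ e → true≢false (trans (sym (bit-odd b b+1<H)) (trans e (bit-beyond b y x<y)))
    where
      b+1<H : suc b < H
      b+1<H = double-<⁻ (suc b) H (≤-trans (≤-reflexive (cong (λ z → suc (suc z)) (+-suc b b))) (≤-trans (s≤s x<y) (≤-trans y<m m≤2H)))
  ... | b , inj₁ refl with m≤n⇒m<n∨m≡n x<y
  ...   | inj₁ 2b+2≤y = b , b<H , λ e → true≢false (trans (sym (bit-even b)) (trans e (bit-beyond b y 2b+2≤y)))
    where
      b<H : b < H
      b<H = double-<⁻ b H (<-trans x<y (≤-trans y<m m≤2H))
  ...   | inj₂ refl with suc b <? H
  ...     | yes b+1<H = suc b , b+1<H , λ e → true≢false (trans (sym (bit-in-run b)) (trans e (bit-hole b)))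
  ...     | no  b+1≮H = b , b<H , λ e → true≢false (trans (sym (bit-even b)) (trans e (bit-last b b+1≮H)))
    where
      b<H : b < H
      b<H = double-<⁻ b H (<-trans x<y (≤-trans y<m m≤2H))

  baseColumn extraColumn : ℕ → Column m
  baseColumn a  = pad m (baseString a)
  extraColumn t = pad m (extraString t)

  weight-baseColumn : ∀ a → a < H → weight (baseColumn a) ≡ baseWeight a
  weight-baseColumn a a<H = weight-pad m (baseString a) (baseString-fits a a<H)

  weight-extraColumn : ∀ t → t < E → weight (extraColumn t) ≡ extraHalf t + extraHalf t
  weight-extraColumn t t<E = trans (weight-pad m (extraString t) (extraString-fits t t<E)) (onesIn-run (extraHalf t + extraHalf t))

  open TwoFamilies weight baseColumn extraColumn H E
    (λ {a} {b} a<b b<H → subst₂ _<_ (sym (weight-baseColumn a (<-trans a<b b<H))) (sym (weight-baseColumn b b<H))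
                           (baseWeight-increasing a<b b<H))
    (λ {s} {t} s<t t<E → subst₂ _<_ (sym (weight-extraColumn s (<-trans s<t t<E))) (sym (weight-extraColumn t t<E))
                           (+-mono-< (extraHalf-increasing s<t) (extraHalf-increasing s<t)))
    (λ {a} {t} a<H t<E e → base≢extra a<H t<E (trans (sym (weight-baseColumn a a<H)) (trans e (weight-extraColumn t t<E))))
    public using (w-injective; family-unique; family-length) renaming (family to removed)

  separates : ∀ i i' → (∀ v → v ∈ removed → lookup v i ≡ lookup v i') → i ≡ i'
  separates i i' agree with <-cmp (toℕ i) (toℕ i')
  ... | tri≈ _ e _ = toℕ-injective e
  ... | tri< i<i' _ _ with separating (toℕ i) (toℕ i') i<i' (toℕ<n i')
  ...   | a , a<H , differ = ⊥-elim (differ (begin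
          bitAt (baseString a) (toℕ i)  ≡⟨ lookup-pad m (baseString a) i ⟨
          lookup (baseColumn a) i       ≡⟨ agree (baseColumn a) (∈-++⁺ˡ (∈-applyUpTo⁺ baseColumn a<H)) ⟩
          lookup (baseColumn a) i'      ≡⟨ lookup-pad m (baseString a) i' ⟩
          bitAt (baseString a) (toℕ i') ∎))
    where open ≡-Reasoning
  separates i i' agree | tri> _ _ i'<i with separating (toℕ i') (toℕ i) i'<i (toℕ<n i)
  ...   | a , a<H , differ = ⊥-elim (differ (begin
          bitAt (baseString a) (toℕ i') ≡⟨ lookup-pad m (baseString a) i' ⟨
          lookup (baseColumn a) i'      ≡⟨ agree (baseColumn a) (∈-++⁺ˡ (∈-applyUpTo⁺ baseColumn a<H)) ⟨
          lookup (baseColumn a) i       ≡⟨ lookup-pad m (baseString a) i ⟩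
          bitAt (baseString a) (toℕ i)  ∎))
    where open ≡-Reasoning

  open Outside removed public using () renaming (outside to kept)
  open Outside removed using (∈-outside⁺; ∈-outside⁻; outside-unique; length-outside)

  kept-rigid : MatrixRigid (columnsOf kept)
  kept-rigid = matrixRigid-by-complement removed kept outside-unique (λ _ → ∈-outside⁺) (λ _ → ∈-outside⁻)
    (λ _ _ → w-injective) separates

  kept-length : length kept + (H + E) ≡ 2 ^ m
  kept-length = trans (cong (length kept +_) (sym family-length)) (length-outside family-unique)

manyColumns : ∀ m k → 5 ≤ m → ⌈ m /2⌉ ≤ k → k + 2 ≤ m → MatrixRigidOrientation m (2 ^ m ∸ k)
manyColumns m k 5≤m H≤k k+2≤m = fromColumns kept length-kept kept-rigid
  where
    H E : ℕ
    H = ⌈ m /2⌉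
    E = k ∸ H

    m≤2H : m ≤ H + H
    m≤2H = ≤-trans (≤-reflexive (sym (⌊n/2⌋+⌈n/2⌉≡n m))) (+-monoˡ-≤ H (⌊n/2⌋≤⌈n/2⌉ m))

    2H≤1+m : H + H ≤ suc m
    2H≤1+m = ≤-trans (+-monoʳ-≤ H (⌊n/2⌋≤⌈n/2⌉ (suc m))) (≤-reflexive (⌊n/2⌋+⌈n/2⌉≡n (suc m)))

    E+H≡k : E + H ≡ k
    E+H≡k = m∸n+n≡m H≤k

    E+2≤H : E + 2 ≤ H
    E+2≤H = +-cancelʳ-≤ H (E + 2) H (begin
      E + 2 + H   ≡⟨ +-assoc E 2 H ⟩
      E + (2 + H) ≡⟨ cong (E +_) (+-comm 2 H) ⟩
      E + (H + 2) ≡⟨ +-assoc E H 2 ⟨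
      E + H + 2   ≡⟨ cong (_+ 2) E+H≡k ⟩
      k + 2       ≤⟨ k+2≤m ⟩
      m           ≤⟨ m≤2H ⟩
      H + H       ∎)
      where open ≤-Reasoning

    open ManyColumns m H E (⌈n/2⌉-mono 5≤m) m≤2H 2H≤1+m E+2≤H

    length-kept : length kept ≡ 2 ^ m ∸ k
    length-kept = begin
      length kept                ≡⟨ m+n∸n≡m (length kept) k ⟨
      length kept + k ∸ k        ≡⟨ cong (λ x → length kept + x ∸ k) (trans (+-comm H E) E+H≡k) ⟨
      length kept + (H + E) ∸ k  ≡⟨ cong (_∸ k) kept-length ⟩
      2 ^ m ∸ k                  ∎
      where open ≡-Reasoning

matrixRigidOrientation : ∀ m n → m < n → Hyp m n → MatrixRigidOrientation m n
matrixRigidOrientation zero    n _ (inj₁ (() , _))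
matrixRigidOrientation (suc m) n m<n (inj₁ (5≤m , n≤P∸H)) with n + m ≤? 2 ^ suc m
... | yes few  = fewColumns m n m<n few
... | no  many = subst (MatrixRigidOrientation (suc m)) (m∸[m∸n]≡n n≤P)
                   (manyColumns (suc m) (P ∸ n) 5≤m H≤P∸n k+2≤M)
  where
    P H : ℕ
    P = 2 ^ suc m
    H = ⌈ suc m /2⌉

    H≤P : H ≤ P
    H≤P = <⇒≤ (m∸n≢0⇒n<m λ P∸H≡0 → <⇒≱ (≤-trans (s≤s z≤n) m<n) (subst (n ≤_) P∸H≡0 n≤P∸H))

    n≤P : n ≤ P
    n≤P = ≤-trans n≤P∸H (m∸n≤m P H)

    H≤P∸n : H ≤ P ∸ n
    H≤P∸n = m+n≤o⇒m≤o∸n H (begin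
      H + n       ≡⟨ +-comm H n ⟩
      n + H       ≤⟨ +-monoˡ-≤ H n≤P∸H ⟩
      P ∸ H + H   ≡⟨ m∸n+n≡m H≤P ⟩
      P           ∎)
      where open ≤-Reasoning

    -- P < n + m, i.e. fewer than m + 2 columns of length m+1 are removed.
    k+2≤M : P ∸ n + 2 ≤ suc m
    k+2≤M = +-cancelʳ-≤ n (P ∸ n + 2) (suc m) (begin
      P ∸ n + 2 + n   ≡⟨ regroup (P ∸ n) n ⟩
      2 + (P ∸ n + n) ≡⟨ cong (2 +_) (m∸n+n≡m n≤P) ⟩
      suc (suc P)     ≤⟨ s≤s (≰⇒> many) ⟩
      suc (n + m)     ≡⟨ +-comm (suc n) m ⟩
      m + suc n       ≡⟨ +-suc m n ⟩
      suc m + n       ∎)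
      where
        open ≤-Reasoning
        regroup : ∀ k n → k + 2 + n ≡ 2 + (k + n)
        regroup = solve-∀
matrixRigidOrientation .2 .3 m<n (inj₂ (inj₁ (refl , refl)))                 = fewColumns 1 3 m<n ≤-refl
matrixRigidOrientation .3 n  m<n (inj₂ (inj₂ (inj₁ (refl , _ , n≤6))))       = fewColumns 2 n m<n (+-monoˡ-≤ 2 n≤6)
matrixRigidOrientation .4 n  m<n (inj₂ (inj₂ (inj₂ (refl , _ , n≤13))))      = fewColumns 3 n m<n (+-monoˡ-≤ 3 n≤13)

rigidOrientation : ∀ m n → m < n → Hyp m n → Σ (Orientation m n) Rigid
rigidOrientation m n m<n hyp with matrixRigidOrientation m n m<n hyp
... | o , matrixRigid = o , rigid-if-matrixRigid o m<n matrixRigid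

rigid⇒vDistinguishing : ∀ {m n r} {o : Orientation m n} → Rigid o → (λv : VLabelling m n r) → VDistinguishing o λv
rigid⇒vDistinguishing rigid _ φ _ = rigid φ

rigid⇒aDistinguishing : ∀ {m n r} {o : Orientation m n} → Rigid o → (ℓ : ALabelling m n r) → ADistinguishing o ℓ
rigid⇒aDistinguishing rigid _ φ _ = rigid φ

-- A proper arc colouring of K_{m,n} (m < n) with n colours: the arc ij gets
-- colour i + j mod n, computed by 'reduce n' on sums below 2n.
reduce : ℕ → ℕ → ℕ
reduce n s with s <? n
... | yes _ = s
... | no  _ = s ∸ n

reduce-cases : ∀ n s → (s < n × reduce n s ≡ s) ⊎ (n ≤ s × reduce n s + n ≡ s)
reduce-cases n s with s <? n
... | yes s<n = inj₁ (s<n , refl)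
... | no  s≮n = inj₂ (≮⇒≥ s≮n , m∸n+n≡m (≮⇒≥ s≮n))

reduce-< : ∀ n s → s < n + n → reduce n s < n
reduce-< n s s<2n with reduce-cases n s
... | inj₁ (s<n , e) = subst (_< n) (sym e) s<n
... | inj₂ (_ , e)   = +-cancelʳ-< n (reduce n s) n (subst (_< n + n) (sym e) s<2n)

reduce-injective : ∀ n a x y → x < n → y < n → reduce n (a + x) ≡ reduce n (a + y) → x ≡ y
reduce-injective n a x y x<n y<n e with reduce-cases n (a + x) | reduce-cases n (a + y)
... | inj₁ (_ , e₁) | inj₁ (_ , e₂) = +-cancelˡ-≡ a x y (trans (sym e₁) (trans e e₂))
... | inj₂ (_ , e₁) | inj₂ (_ , e₂) = +-cancelˡ-≡ a x y (trans (sym e₁) (trans (cong (_+ n) e) e₂))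
... | inj₁ (_ , e₁) | inj₂ (_ , e₂) = ⊥-elim (<⇒≱ y<n (subst (n ≤_) (sym y≡x+n) (m≤n+m n x)))
  where
    y≡x+n : y ≡ x + n
    y≡x+n = +-cancelˡ-≡ a y (x + n) (trans (sym e₂) (trans (cong (_+ n) (trans (sym e) e₁)) (+-assoc a x n)))
... | inj₂ (_ , e₁) | inj₁ (_ , e₂) = ⊥-elim (<⇒≱ x<n (subst (n ≤_) (sym x≡y+n) (m≤n+m n y)))
  where
    x≡y+n : x ≡ y + n
    x≡y+n = +-cancelˡ-≡ a x (y + n) (trans (sym e₁) (trans (cong (_+ n) (trans e e₂)) (+-assoc a y n)))

-- Arcs at a common left vertex i get i + j ≢ i + j' (mod n), arcs at a common
-- right vertex j get i + j ≢ i' + j (mod n), using i, i' < m < n.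
latinColouring : ∀ {m n} → m < n → ALabelling m n n
latinColouring {m} {n} m<n i j =
  fromℕ< (reduce-< n (toℕ i + toℕ j) (+-mono-< (<-trans (toℕ<n i) m<n) (toℕ<n j)))

latinColouring-proper : ∀ {m n} (m<n : m < n) → ProperA (latinColouring m<n)
latinColouring-proper {m} {n} m<n = rowsProper , columnsProper
  where
    same-reduced : ∀ i j i' j' → latinColouring m<n i j ≡ latinColouring m<n i' j' →
      reduce n (toℕ i + toℕ j) ≡ reduce n (toℕ i' + toℕ j')
    same-reduced i j i' j' e = trans (sym (toℕ-fromℕ< _)) (trans (cong toℕ e) (toℕ-fromℕ< _))

    rowsProper : ∀ i j j' → j ≢ j' → latinColouring m<n i j ≢ latinColouring m<n i j'
    rowsProper i j j' j≢j' e =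
      j≢j' (toℕ-injective (reduce-injective n (toℕ i) (toℕ j) (toℕ j') (toℕ<n j) (toℕ<n j') (same-reduced i j i j' e)))

    columnsProper : ∀ i i' j → i ≢ i' → latinColouring m<n i j ≢ latinColouring m<n i' j
    columnsProper i i' j i≢i' e = i≢i' (toℕ-injective (reduce-injective n (toℕ j) (toℕ i) (toℕ i')
      (<-trans (toℕ<n i) m<n) (<-trans (toℕ<n i') m<n)
      (trans (cong (reduce n) (+-comm (toℕ j) (toℕ i))) (trans (same-reduced i j i' j e) (cong (reduce n) (+-comm (toℕ i') (toℕ j)))))))

-- Lower bounds valid for every orientation: a labelling of a nonempty graph
-- needs a label, a proper vertex colouring of an edge two, and a proper arc
-- colouring at a vertex of degree n needs n colours.
inhabited⇒positive : ∀ {r} → Fin r → 1 ≤ r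
inhabited⇒positive i = ≤-trans (s≤s z≤n) (toℕ<n i)

distinct⇒2≤ : ∀ {r} (a b : Fin r) → a ≢ b → 2 ≤ r
distinct⇒2≤ {suc zero}    zero zero a≢b = ⊥-elim (a≢b refl)
distinct⇒2≤ {suc (suc r)} _    _    _   = s≤s (s≤s z≤n)

D-lower : ∀ {m n} → Fin n → (o : Orientation m n) (r : ℕ) → HasD o r → 1 ≤ r
D-lower j _ _ (λv , _) = inhabited⇒positive (λv (inj₂ j))

D'-lower : ∀ {m n} → Fin m → Fin n → (o : Orientation m n) (r : ℕ) → HasD' o r → 1 ≤ r
D'-lower i j _ _ (ℓ , _) = inhabited⇒positive (ℓ i j)

χD-lower : ∀ {m n} → Fin m → Fin n → (o : Orientation m n) (r : ℕ) → HasχD o r → 2 ≤ r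
χD-lower i j _ _ (λv , proper , _) = distinct⇒2≤ (λv (inj₁ i)) (λv (inj₂ j)) (proper i j)

χ'D-lower : ∀ {m n} → Fin m → (o : Orientation m n) (r : ℕ) → HasχD' o r → n ≤ r
χ'D-lower i _ _ (ℓ , (rowsProper , _) , _) = injective⇒≤ {f = ℓ i} injective
  where
    injective : ∀ {j j'} → ℓ i j ≡ ℓ i j' → j ≡ j'
    injective {j} {j'} e with j ≟ᶠ j'
    ... | yes j≡j' = j≡j'
    ... | no  j≢j' = ⊥-elim (rowsProper i j j' j≢j' e)

minimum-attained : ∀ {m n} {Has : Orientation m n → ℕ → Set} {k : ℕ} (o : Orientation m n) →
  Has o k → (∀ o' r → Has o' r → k ≤ r) → MinOverOrientations m n Has k
minimum-attained o has lower = (o , has , lower o) , lower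

-- The corollary always has m ≥ 1, so K_{m,n} has an edge.
hyp⇒0<m : ∀ {m n} → Hyp m n → 0 < m
hyp⇒0<m (inj₁ (5≤m , _))                  = ≤-trans (s≤s z≤n) 5≤m
hyp⇒0<m (inj₂ (inj₁ (refl , _)))          = s≤s z≤n
hyp⇒0<m (inj₂ (inj₂ (inj₁ (refl , _))))   = s≤s z≤n
hyp⇒0<m (inj₂ (inj₂ (inj₂ (refl , _))))   = s≤s z≤n

corollary22 : (m n : ℕ) → m < n → Hyp m n →
    Dmin m n 1 × D'min m n 1 × χDmin m n 2 × χ'Dmin m n n
corollary22 m n m<n hyp =
  minimum-attained o ((λ _ → zero) , rigid⇒vDistinguishing rigid _) (D-lower j) ,
  minimum-attained o ((λ _ _ → zero) , rigid⇒aDistinguishing rigid _) (D'-lower i j) ,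
  minimum-attained o (sides , (λ _ _ ()) , rigid⇒vDistinguishing rigid sides) (χD-lower i j) ,
  minimum-attained o (latinColouring m<n , latinColouring-proper m<n , rigid⇒aDistinguishing rigid _) (χ'D-lower i)
  where
    i : Fin m
    i = fromℕ< (hyp⇒0<m hyp)
    j : Fin n
    j = fromℕ< m<n
    o : Orientation m n
    o = proj₁ (rigidOrientation m n m<n hyp)
    rigid : Rigid o
    rigid = proj₂ (rigidOrientation m n m<n hyp)
    sides : VLabelling m n 2
    sides (inj₁ _) = zero
    sides (inj₂ _) = suc zero
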